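{- Let $G$ and $H$ be modular graphs, each with at least $3$ vertices. Then $$SW_3(G\square H) = \big(|V(G)|\cdot|V(H)|-2\big) \left( \frac{|V(G)|^2 }{|V(H)|-2}\, SW_3(H)+\frac{|V(H)|^2}{|V(G)|-2}\, SW_3(G) \right).$$
   Context: For a connected graph $G$ and $u,v\in V(G)$, $d(u,v)$ is the shortest-path distance. For $S\subseteq V(G)$, the Steiner distance $d(S)$ is the minimum number of edges of a connected subgraph of $G$ containing all vertices of $S$, and $SW_3(G)=\sum_{S\subseteq V(G),\,|S|=3} d(S)$. The interval $I(u,v)$ is the set of vertices lying on some shortest $u,v$-path. A connected graph is modular if for every three vertices $x,y,z$ one has $I(x,y)\cap I(x,z)\cap I(y,z)\neq\emptyset$. The Cartesian product $G\square H$ has vertex set $V(G)\times V(H)$, with $(a,x)(b,y)$ an edge iff either $ab\in E(G)$ and $x=y$, or $a=b$ and $xy\in E(H)$. -}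

module Defs where

open import Data.Nat using (ℕ; zero; suc; _+_; _≤_)
open import Data.Fin as Fin using (Fin; remQuot; _<?_)
open import Data.Product using (Σ; ∃; _×_; _,_; proj₁; proj₂)
open import Data.Sum using (_⊎_)
open import Data.List using (List; []; _∷_; length; map; concatMap; filter; allFin)
open import Data.Nat.ListAction using (sum)
open import Data.List.Relation.Unary.All using (All)
open import Data.List.Relation.Unary.Unique.Propositional using (Unique)
open import Data.List.Membership.Propositional using (_∈_)
open import Relation.Binary.PropositionalEquality using (_≡_)
open import Relation.Nullary using (¬_)
open import Relation.Nullary.Decidable using (_×-dec_)

record Graph : Set₁ where
  field
    n     : ℕ
    Adj   : Fin n → Fin n → Set
    sym   : ∀ {u v} → Adj u v → Adj v u
    irref : ∀ {u} → ¬ Adj u u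
open Graph public

data Walk (G : Graph) : Fin (n G) → Fin (n G) → ℕ → Set where
  [] : ∀ {u} → Walk G u u 0
  _∷_ : ∀ {u w v k} → Adj G u w → Walk G w v k → Walk G u v (suc k)

data Visits (G : Graph) (x : Fin (n G)) : ∀ {u v k} → Walk G u v k → Set where
  here  : ∀ {v k} (p : Walk G x v k) → Visits G x p
  there : ∀ {u w v k} (e : Adj G u w) (p : Walk G w v k) → Visits G x p → Visits G x (e ∷ p)

Connected : Graph → Set
Connected G = ∀ (u v : Fin (n G)) → ∃ λ k → Walk G u v k

IsDist : (G : Graph) → Fin (n G) → Fin (n G) → ℕ → Set
IsDist G u v k = Walk G u v k × (∀ m → Walk G u v m → k ≤ m)

InInterval : (G : Graph) → Fin (n G) → Fin (n G) → Fin (n G) → Set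
InInterval G u v w = ∃ λ k → IsDist G u v k × Σ (Walk G u v k) (λ p → Visits G w p)

Modular : Graph → Set
Modular G = Connected G ×
  (∀ x y z → ∃ λ w → InInterval G x y w × InInterval G x z w × InInterval G y z w)

-- an edge {a,b} is stored as the ordered pair (a , b) with a < b
record Subgraph (G : Graph) : Set₁ where
  field
    inV      : Fin (n G) → Set
    edges    : List (Fin (n G) × Fin (n G))
    edges-ok : All (λ e → (proj₁ e Fin.< proj₂ e) × Adj G (proj₁ e) (proj₂ e)
                        × inV (proj₁ e) × inV (proj₂ e)) edges
    distinct : Unique edges
open Subgraph public

EdgeIn : ∀ {G} → Subgraph G → Fin (n G) → Fin (n G) → Set
EdgeIn S a b = ((a , b) ∈ edges S) ⊎ ((b , a) ∈ edges S)

data SubWalk {G : Graph} (S : Subgraph G) : Fin (n G) → Fin (n G) → Set where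
  [] : ∀ {u} → SubWalk S u u
  _∷_ : ∀ {u w v} → EdgeIn S u w → SubWalk S w v → SubWalk S u v

SubConnected : ∀ {G} → Subgraph G → Set
SubConnected S = ∀ u v → inV S u → inV S v → SubWalk S u v

ConnContaining : (G : Graph) → Subgraph G → Fin (n G) → Fin (n G) → Fin (n G) → Set
ConnContaining G S a b c = SubConnected S × inV S a × inV S b × inV S c

IsSteinerDist : (G : Graph) → Fin (n G) → Fin (n G) → Fin (n G) → ℕ → Set₁
IsSteinerDist G a b c k =
  (Σ (Subgraph G) λ S → ConnContaining G S a b c × length (edges S) ≡ k)
  × (∀ (S : Subgraph G) → ConnContaining G S a b c → k ≤ length (edges S))

IsSteiner3 : (G : Graph) → (Fin (n G) → Fin (n G) → Fin (n G) → ℕ) → Set₁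
IsSteiner3 G d = ∀ a b c → a Fin.< b → b Fin.< c → IsSteinerDist G a b c (d a b c)

triples : (m : ℕ) → List (Fin m × Fin m × Fin m)
triples m = filter (λ t → (proj₁ t <? proj₁ (proj₂ t)) ×-dec (proj₁ (proj₂ t) <? proj₂ (proj₂ t)))
  (concatMap (λ a → concatMap (λ b → map (λ c → (a , b , c)) (allFin m)) (allFin m)) (allFin m))

SW3 : (G : Graph) → (Fin (n G) → Fin (n G) → Fin (n G) → ℕ) → ℕ
SW3 G d = sum (map (λ t → d (proj₁ t) (proj₁ (proj₂ t)) (proj₂ (proj₂ t))) (triples (n G)))

-- Cartesian product; vertex (a , x) is encoded as combine a x : Fin (n G * n H)

open import Data.Nat using (_*_)
open import Function using (_∘_)

□Adj : (G H : Graph) → Fin (n G * n H) → Fin (n G * n H) → Set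
□Adj G H i j with remQuot {n G} (n H) i | remQuot {n G} (n H) j
... | (a , x) | (b , y) = (Adj G a b × x ≡ y) ⊎ (a ≡ b × Adj H x y)

□sym : ∀ G H {i j} → □Adj G H i j → □Adj G H j i
□sym G H {i} {j} p with remQuot {n G} (n H) i | remQuot {n G} (n H) j
... | (a , x) | (b , y) = Data.Sum.map (λ q → sym G (proj₁ q) , Eq.sym (proj₂ q))
                                      (λ q → Eq.sym (proj₁ q) , Graph.sym H (proj₂ q)) p
  where import Relation.Binary.PropositionalEquality as Eq
        import Data.Sum

□irr : ∀ G H {i} → ¬ □Adj G H i i
□irr G H {i} p with remQuot {n G} (n H) i
... | (a , x) = Data.Sum.[ (λ q → irref G (proj₁ q)) , (λ q → irref H (proj₂ q)) ] p
  where import Data.Sum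

_□_ : Graph → Graph → Graph
G □ H = record { n = n G * n H ; Adj = □Adj G H ; sym = □sym G H ; irref = □irr G H }

-- Work with a distance function in which every triple x, y, z has a median: a vertex w with
-- d(x,w) + d(w,y) = d(x,y), and likewise for the other two pairs. Modular graphs have medians,
-- and so does G □ H, since distances there add coordinatewise and medians can be taken
-- coordinatewise. With medians, the Steiner distance of {a, b, c} is half of
-- d(a,b) + d(b,c) + d(a,c): the three geodesics to a median span a connected subgraph of that
-- size, and conversely any connected subgraph containing a, b, c holds an a–b path together with
-- an edge-disjoint path from c to it. Every pair lies in |V| − 2 three-element subsets, so
-- 2·SW₃(G) = (|V| − 2)·W(G) for the Wiener index W, and W(G □ H) = |H|²·W(G) + |G|²·W(H).
-- Clearing denominators gives the formula.

module Submission where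

open import Defs hiding (sym)
open import Data.Nat using (ℕ; zero; suc; _+_; _*_; _∸_; _^_; _≤_; z≤n; s≤s)
open import Data.Nat.Properties
  using ( +-*-semiring; +-assoc; +-comm; +-suc; +-identityʳ; *-identityˡ; *-identityʳ; *-zeroʳ; *-assoc
        ; *-cancelˡ-≡; m+n∸n≡m; n≤0⇒n≡0; ≤-antisym; ≤-trans; ≤-reflexive; +-mono-≤; *-monoʳ-≤
        ; module ≤-Reasoning)
open import Data.Nat.ListAction using (sum)
open import Data.Nat.ListAction.Properties using (sum-++)
open import Data.Nat.Tactic.RingSolver using (solve-∀)
open import Data.Fin as Fin using (Fin; zero; suc; _↑ˡ_; _↑ʳ_; combine; remQuot; _<?_)
open import Data.Fin.Properties
  using (_≟_; <-cmp; <-trans; <-irrefl; <-asym; <⇒≢; remQuot-combine; combine-remQuot)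
open import Data.List
  using (List; []; _∷_; _++_; length; map; filter; concatMap; allFin; tabulate; deduplicate)
open import Data.List.Properties using (map-++; map-∘; length-++; length-++-sucʳ)
open import Data.List.Membership.Propositional using (_∈_)
open import Data.List.Membership.Propositional.Properties
  using (∈-∃++; ∈-++⁻; ∈-++⁺ˡ; ∈-++⁺ʳ; ∈-deduplicate⁺; ∈-deduplicate⁻)
open import Data.List.Relation.Unary.All as All using (All; []; _∷_)
open import Data.List.Relation.Unary.All.Properties using (++⁺)
open import Data.List.Relation.Unary.Any using (here; there)
open import Data.List.Relation.Unary.Unique.Propositional using (Unique; []; _∷_)
import Data.List.Relation.Unary.Unique.Propositional.Properties as Unique
open import Data.List.Relation.Unary.Unique.DecPropositional.Properties using (deduplicate-!)
open import Data.Product using (Σ; ∃; ∃₂; _×_; _,_; proj₁; proj₂)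
open import Data.Product.Properties using (≡-dec)
open import Data.Sum using (_⊎_; inj₁; inj₂)
open import Data.Unit using (⊤; tt)
open import Data.Empty using (⊥-elim)
open import Function using (_∘_)
open import Relation.Nullary using (Dec; yes; no; ¬_)
open import Relation.Nullary.Decidable using (_×-dec_)
open import Relation.Unary using (Pred; Decidable)
open import Relation.Binary.Definitions using (tri<; tri≈; tri>)
open import Relation.Binary.PropositionalEquality
  using (_≡_; _≢_; ≢-sym; refl; sym; trans; cong; cong₂; subst; subst₂; module ≡-Reasoning)
open import Algebra.Properties.Semiring.Sum +-*-semiring
  using (sum-syntax; sum-cong-≗; ∑-distrib-+; ∑-comm; *-distribˡ-sum)
  renaming (sum to ∑)

-- Finite sums

∑-const : ∀ m k → ∑[ i < m ] k ≡ m * k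
∑-const zero    k = refl
∑-const (suc m) k = cong (k +_) (∑-const m k)

∑-zero : ∀ m → ∑[ i < m ] 0 ≡ 0
∑-zero m = trans (∑-const m 0) (*-zeroʳ m)

∑-↑ : ∀ m k (f : Fin (m + k) → ℕ) → ∑ f ≡ ∑[ i < m ] f (i ↑ˡ k) + ∑[ j < k ] f (m ↑ʳ j)
∑-↑ zero    k f = refl
∑-↑ (suc m) k f = trans (cong (f zero +_) (∑-↑ m k (f ∘ suc))) (sym (+-assoc (f zero) _ _))

∑-combine : ∀ m k (f : Fin (m * k) → ℕ) → ∑ f ≡ ∑[ i < m ] ∑[ j < k ] f (combine i j)
∑-combine zero    k f = refl
∑-combine (suc m) k f =
  trans (∑-↑ k (m * k) f) (cong (∑[ j < k ] f (j ↑ˡ m * k) +_) (∑-combine m k (f ∘ (k ↑ʳ_))))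

∑² : ∀ {m} → (Fin m → Fin m → ℕ) → ℕ
∑² {m} f = ∑[ a < m ] ∑[ b < m ] f a b

∑³ : ∀ {m} → (Fin m → Fin m → Fin m → ℕ) → ℕ
∑³ {m} f = ∑[ a < m ] ∑[ b < m ] ∑[ c < m ] f a b c

∑²-cong : ∀ {m} {f g : Fin m → Fin m → ℕ} → (∀ a b → f a b ≡ g a b) → ∑² f ≡ ∑² g
∑²-cong {m} f≗g = sum-cong-≗ {m} (λ a → sum-cong-≗ {m} (f≗g a))

∑³-cong : ∀ {m} {f g : Fin m → Fin m → Fin m → ℕ} →
  (∀ a b c → f a b c ≡ g a b c) → ∑³ f ≡ ∑³ g
∑³-cong {m} f≗g = sum-cong-≗ {m} (λ a → ∑²-cong (f≗g a))

∑²-distrib-+ : ∀ {m} (f g : Fin m → Fin m → ℕ) → ∑² (λ a b → f a b + g a b) ≡ ∑² f + ∑² g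
∑²-distrib-+ {m} f g = trans (sum-cong-≗ {m} (λ a → ∑-distrib-+ (f a) (g a)))
                              (∑-distrib-+ (λ a → ∑ (f a)) (λ a → ∑ (g a)))

∑³-distrib-+ : ∀ {m} (f g : Fin m → Fin m → Fin m → ℕ) →
  ∑³ (λ a b c → f a b c + g a b c) ≡ ∑³ f + ∑³ g
∑³-distrib-+ {m} f g = trans (sum-cong-≗ {m} (λ a → ∑²-distrib-+ (f a) (g a)))
                              (∑-distrib-+ (λ a → ∑² (f a)) (λ a → ∑² (g a)))

*-distribˡ-∑² : ∀ {m} x (f : Fin m → Fin m → ℕ) → ∑² (λ a b → x * f a b) ≡ x * ∑² f
*-distribˡ-∑² {m} x f =
  sym (trans (*-distribˡ-sum x (λ a → ∑ (f a))) (sum-cong-≗ {m} (λ a → *-distribˡ-sum x (f a))))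

∑²-combine : ∀ g h (DG : Fin g → Fin g → ℕ) (DH : Fin h → Fin h → ℕ)
  (DP : Fin (g * h) → Fin (g * h) → ℕ) →
  (∀ a x b y → DP (combine a x) (combine b y) ≡ DG a b + DH x y) →
  ∑² DP ≡ h * h * ∑² DG + g * g * ∑² DH
∑²-combine g h DG DH DP DP-combine = begin
  ∑² DP
    ≡⟨ ∑-combine g h (λ i → ∑ (DP i)) ⟩
  ∑[ a < g ] ∑[ x < h ] ∑[ j < g * h ] DP (combine a x) j
    ≡⟨ sum-cong-≗ {g} (λ a → sum-cong-≗ {h} (λ x → ∑-combine g h (DP (combine a x)))) ⟩
  ∑[ a < g ] ∑[ x < h ] ∑[ b < g ] ∑[ y < h ] DP (combine a x) (combine b y)
    ≡⟨ sum-cong-≗ {g} (λ a → sum-cong-≗ {h} (λ x → sum-cong-≗ {g} (λ b → inner a x b))) ⟩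
  ∑[ a < g ] ∑[ x < h ] ∑[ b < g ] (h * DG a b + ∑ (DH x))
    ≡⟨ sum-cong-≗ {g} (λ a → sum-cong-≗ {h} (λ x → middle a x)) ⟩
  ∑[ a < g ] ∑[ x < h ] (h * ∑ (DG a) + g * ∑ (DH x))
    ≡⟨ sum-cong-≗ {g} outer ⟩
  ∑[ a < g ] (h * (h * ∑ (DG a)) + g * ∑² DH)
    ≡⟨ ∑-distrib-+ (λ a → h * (h * ∑ (DG a))) (λ _ → g * ∑² DH) ⟩
  ∑[ a < g ] (h * (h * ∑ (DG a))) + ∑[ a < g ] (g * ∑² DH)
    ≡⟨ cong₂ _+_ (sym pull-h) (trans (∑-const g (g * ∑² DH)) (sym (*-assoc g g (∑² DH)))) ⟩
  h * h * ∑² DG + g * g * ∑² DH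
    ∎
  where
  open ≡-Reasoning
  inner : ∀ a x b → ∑[ y < h ] DP (combine a x) (combine b y) ≡ h * DG a b + ∑ (DH x)
  inner a x b = trans (sum-cong-≗ {h} (DP-combine a x b))
    (trans (∑-distrib-+ (λ _ → DG a b) (DH x)) (cong (_+ ∑ (DH x)) (∑-const h (DG a b))))
  middle : ∀ a x → ∑[ b < g ] (h * DG a b + ∑ (DH x)) ≡ h * ∑ (DG a) + g * ∑ (DH x)
  middle a x = trans (∑-distrib-+ (λ b → h * DG a b) (λ _ → ∑ (DH x)))
    (cong₂ _+_ (sym (*-distribˡ-sum h (DG a))) (∑-const g (∑ (DH x))))
  pull-h : h * h * ∑² DG ≡ ∑[ a < g ] (h * (h * ∑ (DG a)))
  pull-h = trans (*-assoc h h (∑² DG)) (trans (cong (h *_) (*-distribˡ-sum h (λ a → ∑ (DG a))))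
    (*-distribˡ-sum h (λ a → h * ∑ (DG a))))
  outer : ∀ a → ∑[ x < h ] (h * ∑ (DG a) + g * ∑ (DH x)) ≡ h * (h * ∑ (DG a)) + g * ∑² DH
  outer a = trans (∑-distrib-+ (λ _ → h * ∑ (DG a)) (λ x → g * ∑ (DH x)))
    (cong₂ _+_ (∑-const h (h * ∑ (DG a))) (sym (*-distribˡ-sum g (λ x → ∑ (DH x)))))

-- Sums over increasing pairs and triples

χ : ∀ {P : Set} → Dec P → ℕ
χ (yes _) = 1
χ (no _)  = 0

χ-yes : ∀ {P : Set} (P? : Dec P) → P → χ P? ≡ 1
χ-yes (yes _) _  = refl
χ-yes (no ¬p) p = ⊥-elim (¬p p)

χ-no : ∀ {P : Set} (P? : Dec P) → ¬ P → χ P? ≡ 0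
χ-no (yes p) ¬p = ⊥-elim (¬p p)
χ-no (no _)  _  = refl

χ-× : ∀ {P Q : Set} (P? : Dec P) (Q? : Dec Q) → χ (P? ×-dec Q?) ≡ χ P? * χ Q?
χ-× (yes _) (yes _) = refl
χ-× (yes _) (no _)  = refl
χ-× (no _)  _       = refl

sum-map-tabulate : ∀ {A : Set} {m} (g : A → ℕ) (f : Fin m → A) → sum (map g (tabulate f)) ≡ ∑ (g ∘ f)
sum-map-tabulate {m = zero}  g f = refl
sum-map-tabulate {m = suc m} g f = cong (g (f zero) +_) (sum-map-tabulate g (f ∘ suc))

sum-map-concatMap : ∀ {A B : Set} (g : A → ℕ) (f : B → List A) xs →
  sum (map g (concatMap f xs)) ≡ sum (map (λ x → sum (map g (f x))) xs)
sum-map-concatMap g f []       = refl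
sum-map-concatMap g f (x ∷ xs) = begin
  sum (map g (f x ++ concatMap f xs))               ≡⟨ cong sum (map-++ g (f x) _) ⟩
  sum (map g (f x) ++ map g (concatMap f xs))       ≡⟨ sum-++ (map g (f x)) _ ⟩
  sum (map g (f x)) + sum (map g (concatMap f xs))  ≡⟨ cong (_ +_) (sum-map-concatMap g f xs) ⟩
  sum (map (λ x → sum (map g (f x))) (x ∷ xs))      ∎
  where open ≡-Reasoning

sum-map-allFin : ∀ m (g : Fin m → ℕ) → sum (map g (allFin m)) ≡ ∑ g
sum-map-allFin m g = sum-map-tabulate g (λ i → i)

sum-map-filter : ∀ {A : Set} {P : Pred A _} (P? : Decidable P) (g : A → ℕ) xs →
  sum (map g (filter P? xs)) ≡ sum (map (λ x → χ (P? x) * g x) xs)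
sum-map-filter P? g [] = refl
sum-map-filter P? g (x ∷ xs) with P? x
... | yes _ = cong₂ _+_ (sym (+-identityʳ (g x))) (sum-map-filter P? g xs)
... | no _  = sum-map-filter P? g xs

𝟙[_<_] : ∀ {m} → Fin m → Fin m → ℕ
𝟙[ a < b ] = χ (a <? b)

𝟙[_≡_] : ∀ {m} → Fin m → Fin m → ℕ
𝟙[ a ≡ b ] = χ (a ≟ b)

∑< : ∀ {m} → (Fin m → Fin m → ℕ) → ℕ
∑< f = ∑² (λ a b → 𝟙[ a < b ] * f a b)

∑<< : ∀ {m} → (Fin m → Fin m → Fin m → ℕ) → ℕ
∑<< f = ∑³ (λ a b c → 𝟙[ a < b ] * (𝟙[ b < c ] * f a b c))

sum-triples : ∀ m (f : Fin m → Fin m → Fin m → ℕ) →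
  sum (map (λ t → f (proj₁ t) (proj₁ (proj₂ t)) (proj₂ (proj₂ t))) (triples m)) ≡ ∑<< f
sum-triples m f = begin
  sum (map F (filter P? (concatMap plane (allFin m))))  ≡⟨ sum-map-filter P? F (concatMap plane (allFin m)) ⟩
  sum (map G (concatMap plane (allFin m)))              ≡⟨ sum-map-concatMap G plane (allFin m) ⟩
  sum (map (λ a → sum (map G (plane a))) (allFin m))    ≡⟨ sum-map-allFin m _ ⟩
  ∑[ a < m ] sum (map G (plane a))                      ≡⟨ sum-cong-≗ {m} sum-plane ⟩
  ∑³ (λ a b c → G (a , b , c))                          ≡⟨ ∑³-cong factor ⟩
  ∑<< f                                                 ∎
  where
  open ≡-Reasoning
  F : Fin m × Fin m × Fin m → ℕ
  F (a , b , c) = f a b c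
  Increasing : Fin m × Fin m × Fin m → Set
  Increasing (a , b , c) = a Fin.< b × b Fin.< c
  P? : Decidable Increasing
  P? (a , b , c) = (a <? b) ×-dec (b <? c)
  G : Fin m × Fin m × Fin m → ℕ
  G t = χ (P? t) * F t
  plane : Fin m → List (Fin m × Fin m × Fin m)
  plane a = concatMap (λ b → map (λ c → (a , b , c)) (allFin m)) (allFin m)
  sum-plane : ∀ a → sum (map G (plane a)) ≡ ∑[ b < m ] ∑[ c < m ] G (a , b , c)
  sum-plane a = trans (sum-map-concatMap G _ (allFin m)) (trans (sum-map-allFin m _)
    (sum-cong-≗ {m} (λ b → trans (cong sum (sym (map-∘ (allFin m)))) (sum-map-allFin m _))))
  factor : ∀ a b c → G (a , b , c) ≡ 𝟙[ a < b ] * (𝟙[ b < c ] * f a b c)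
  factor a b c = trans (cong (_* f a b c) (χ-× (a <? b) (b <? c))) (*-assoc 𝟙[ a < b ] _ _)

module _ {m : ℕ} {a b : Fin m} where

  𝟙<-yes : a Fin.< b → 𝟙[ a < b ] ≡ 1
  𝟙<-yes = χ-yes (a <? b)

  𝟙<-no : ¬ a Fin.< b → 𝟙[ a < b ] ≡ 0
  𝟙<-no = χ-no (a <? b)

  𝟙≡-no : a ≢ b → 𝟙[ a ≡ b ] ≡ 0
  𝟙≡-no = χ-no (a ≟ b)

𝟙≡-refl : ∀ {m} (a : Fin m) → 𝟙[ a ≡ a ] ≡ 1
𝟙≡-refl a = χ-yes (a ≟ a) refl

∑-𝟙≡ : ∀ {m} (a : Fin m) → ∑[ c < m ] 𝟙[ c ≡ a ] ≡ 1
∑-𝟙≡ {suc m} zero    = cong suc (∑-zero m)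
∑-𝟙≡ {suc m} (suc a) = trans (sum-cong-≗ {m} 𝟙≡-suc) (∑-𝟙≡ a)
  where
  𝟙≡-suc : ∀ c → 𝟙[ suc c ≡ suc a ] ≡ 𝟙[ c ≡ a ]
  𝟙≡-suc c with c ≟ a
  ... | yes _ = refl
  ... | no _  = refl

trichotomy₅ : ∀ {m} {a b : Fin m} → a Fin.< b → ∀ c →
  𝟙[ b < c ] + 𝟙[ c < a ] + 𝟙[ a < c ] * 𝟙[ c < b ] + (𝟙[ c ≡ a ] + 𝟙[ c ≡ b ]) ≡ 1
trichotomy₅ {a = a} {b} a<b c with <-cmp c a | <-cmp c b
... | tri< c<a _ _ | _
  rewrite 𝟙<-no (<-asym (<-trans c<a a<b)) | 𝟙<-yes c<a | 𝟙<-no (<-asym c<a)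
        | 𝟙≡-no (<⇒≢ c<a) | 𝟙≡-no (<⇒≢ (<-trans c<a a<b)) = refl
... | tri≈ _ refl _ | _
  rewrite 𝟙<-no (<-asym a<b) | 𝟙<-no (<-irrefl {x = c} refl) | 𝟙≡-refl c | 𝟙≡-no (<⇒≢ a<b) = refl
... | tri> _ _ a<c | tri< c<b _ _
  rewrite 𝟙<-no (<-asym c<b) | 𝟙<-no (<-asym a<c) | 𝟙<-yes a<c | 𝟙<-yes c<b
        | 𝟙≡-no (≢-sym (<⇒≢ a<c)) | 𝟙≡-no (<⇒≢ c<b) = refl
... | tri> _ _ _ | tri≈ _ refl _
  rewrite 𝟙<-no (<-irrefl {x = c} refl) | 𝟙<-no (<-asym a<b) | 𝟙<-yes a<b
        | 𝟙≡-no (≢-sym (<⇒≢ a<b)) | 𝟙≡-refl c = refl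
... | tri> _ _ a<c | tri> _ _ b<c
  rewrite 𝟙<-yes b<c | 𝟙<-no (<-asym a<c) | 𝟙<-yes a<c | 𝟙<-no (<-asym b<c)
        | 𝟙≡-no (≢-sym (<⇒≢ a<c)) | 𝟙≡-no (≢-sym (<⇒≢ b<c)) = refl

count-completions : ∀ {m} {a b : Fin m} → a Fin.< b →
  ∑[ c < m ] 𝟙[ b < c ] + ∑[ c < m ] 𝟙[ c < a ] + ∑[ c < m ] (𝟙[ a < c ] * 𝟙[ c < b ]) ≡ m ∸ 2
count-completions {m} {a} {b} a<b = begin
  N                     ≡⟨ sym (m+n∸n≡m N 2) ⟩
  N + (1 + 1) ∸ 2       ≡⟨ cong (λ k → N + k ∸ 2) (sym (cong₂ _+_ (∑-𝟙≡ a) (∑-𝟙≡ b))) ⟩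
  N + (∑ E + ∑ F) ∸ 2   ≡⟨ cong (_∸ 2) (sym ∑-partition) ⟩
  ∑[ c < m ] 1 ∸ 2      ≡⟨ cong (_∸ 2) (trans (∑-const m 1) (*-identityʳ m)) ⟩
  m ∸ 2                 ∎
  where
  open ≡-Reasoning
  A B C E F : Fin m → ℕ
  A c = 𝟙[ b < c ]
  B c = 𝟙[ c < a ]
  C c = 𝟙[ a < c ] * 𝟙[ c < b ]
  E c = 𝟙[ c ≡ a ]
  F c = 𝟙[ c ≡ b ]
  N = ∑ A + ∑ B + ∑ C
  ∑-partition : ∑[ c < m ] 1 ≡ N + (∑ E + ∑ F)
  ∑-partition = begin
    ∑[ c < m ] 1
      ≡⟨ sum-cong-≗ {m} (λ c → sym (trichotomy₅ a<b c)) ⟩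
    ∑[ c < m ] (A c + B c + C c + (E c + F c))
      ≡⟨ ∑-distrib-+ (λ c → A c + B c + C c) (λ c → E c + F c) ⟩
    ∑[ c < m ] (A c + B c + C c) + ∑[ c < m ] (E c + F c)
      ≡⟨ cong₂ _+_ (trans (∑-distrib-+ (λ c → A c + B c) C) (cong (_+ ∑ C) (∑-distrib-+ A B)))
                   (∑-distrib-+ E F) ⟩
    N + (∑ E + ∑ F)
      ∎

∑-between-≮ : ∀ {m} {a b : Fin m} → ¬ a Fin.< b → ∑[ c < m ] (𝟙[ a < c ] * 𝟙[ c < b ]) ≡ 0
∑-between-≮ {m} {a} {b} a≮b = trans (sum-cong-≗ {m} between-empty) (∑-zero m)
  where
  between-empty : ∀ c → 𝟙[ a < c ] * 𝟙[ c < b ] ≡ 0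
  between-empty c with a <? c
  ... | yes a<c = trans (*-identityˡ 𝟙[ c < b ]) (𝟙<-no (λ c<b → a≮b (<-trans a<c c<b)))
  ... | no _    = refl

completion-weight : ∀ {m} (a b : Fin m) (x : ℕ) →
  𝟙[ a < b ] * x * ∑[ c < m ] 𝟙[ b < c ] + 𝟙[ a < b ] * x * ∑[ c < m ] 𝟙[ c < a ]
    + x * ∑[ c < m ] (𝟙[ a < c ] * 𝟙[ c < b ]) ≡ (m ∸ 2) * (𝟙[ a < b ] * x)
completion-weight {m} a b x with a <? b
... | yes a<b = trans (factor-out _ _ _ x) (cong (_* (1 * x)) (count-completions a<b))
  where
  factor-out : ∀ p q r x → 1 * x * p + 1 * x * q + x * r ≡ (p + q + r) * (1 * x)
  factor-out = solve-∀
... | no a≮b rewrite ∑-between-≮ a≮b | *-zeroʳ x | *-zeroʳ (m ∸ 2) = refl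

∑<<-pairs : ∀ {m} (D : Fin m → Fin m → ℕ) →
  ∑<< (λ a b c → D a b + D b c + D a c) ≡ (m ∸ 2) * ∑< D
∑<<-pairs {m} D = begin
  ∑<< (λ a b c → D a b + D b c + D a c)
    ≡⟨ ∑³-cong (λ a b c → expand 𝟙[ a < b ] 𝟙[ b < c ] (D a b) (D b c) (D a c)) ⟩
  ∑³ (λ a b c → T₁ a b c + T₂ a b c + T₃ a b c)
    ≡⟨ trans (∑³-distrib-+ (λ a b c → T₁ a b c + T₂ a b c) T₃) (cong (_+ ∑³ T₃) (∑³-distrib-+ T₁ T₂)) ⟩
  ∑³ T₁ + ∑³ T₂ + ∑³ T₃
    ≡⟨ cong₂ _+_ (cong₂ _+_ ∑T₁ ∑T₂) ∑T₃ ⟩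
  ∑² W₁ + ∑² W₂ + ∑² W₃
    ≡⟨ sym (trans (∑²-distrib-+ (λ a b → W₁ a b + W₂ a b) W₃) (cong (_+ ∑² W₃) (∑²-distrib-+ W₁ W₂))) ⟩
  ∑² (λ a b → W₁ a b + W₂ a b + W₃ a b)
    ≡⟨ ∑²-cong (λ a b → completion-weight a b (D a b)) ⟩
  ∑² (λ a b → (m ∸ 2) * (𝟙[ a < b ] * D a b))
    ≡⟨ *-distribˡ-∑² (m ∸ 2) (λ a b → 𝟙[ a < b ] * D a b) ⟩
  (m ∸ 2) * ∑< D
    ∎
  where
  open ≡-Reasoning
  expand : ∀ s t x y z → s * (t * (x + y + z)) ≡ s * x * t + t * y * s + z * (s * t)
  expand = solve-∀
  T₁ T₂ T₃ : Fin m → Fin m → Fin m → ℕ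
  T₁ a b c = 𝟙[ a < b ] * D a b * 𝟙[ b < c ]
  T₂ a b c = 𝟙[ b < c ] * D b c * 𝟙[ a < b ]
  T₃ a b c = D a c * (𝟙[ a < b ] * 𝟙[ b < c ])
  W₁ W₂ W₃ : Fin m → Fin m → ℕ
  W₁ a b = 𝟙[ a < b ] * D a b * ∑[ c < m ] 𝟙[ b < c ]
  W₂ a b = 𝟙[ a < b ] * D a b * ∑[ c < m ] 𝟙[ c < a ]
  W₃ a b = D a b * ∑[ c < m ] (𝟙[ a < c ] * 𝟙[ c < b ])
  ∑T₁ : ∑³ T₁ ≡ ∑² W₁
  ∑T₁ = ∑²-cong (λ a b → sym (*-distribˡ-sum (𝟙[ a < b ] * D a b) (λ c → 𝟙[ b < c ])))
  ∑T₂ : ∑³ T₂ ≡ ∑² W₂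
  ∑T₂ = trans (∑-comm (λ a b → ∑[ c < m ] T₂ a b c))
          (sum-cong-≗ {m} (λ b → trans (∑-comm (λ a c → T₂ a b c))
            (sum-cong-≗ {m} (λ c → sym (*-distribˡ-sum (𝟙[ b < c ] * D b c) (λ a → 𝟙[ a < b ]))))))
  ∑T₃ : ∑³ T₃ ≡ ∑² W₃
  ∑T₃ = sum-cong-≗ {m} (λ a → trans (∑-comm (λ b c → T₃ a b c))
          (sum-cong-≗ {m} (λ c → sym (*-distribˡ-sum (D a c) (λ b → 𝟙[ a < b ] * 𝟙[ b < c ])))))

∑<<-cong : ∀ {m} {f g : Fin m → Fin m → Fin m → ℕ} →
  (∀ a b c → a Fin.< b → b Fin.< c → f a b c ≡ g a b c) → ∑<< f ≡ ∑<< g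
∑<<-cong {f = f} {g} f≡g = ∑³-cong pointwise
  where
  pointwise : ∀ a b c → 𝟙[ a < b ] * (𝟙[ b < c ] * f a b c) ≡ 𝟙[ a < b ] * (𝟙[ b < c ] * g a b c)
  pointwise a b c with a <? b | b <? c
  ... | yes a<b | yes b<c = cong (λ v → 1 * (1 * v)) (f≡g a b c a<b b<c)
  ... | yes _   | no _    = refl
  ... | no _    | _       = refl

*-distribˡ-∑<< : ∀ {m} x (f : Fin m → Fin m → Fin m → ℕ) → x * ∑<< f ≡ ∑<< (λ a b c → x * f a b c)
*-distribˡ-∑<< {m} x f = begin
  x * ∑<< f                     ≡⟨ *-distribˡ-sum x (λ a → ∑² (F a)) ⟩
  ∑[ a < m ] (x * ∑² (F a))     ≡⟨ sum-cong-≗ {m} (λ a → sym (*-distribˡ-∑² x (F a))) ⟩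
  ∑³ (λ a b c → x * F a b c)    ≡⟨ ∑³-cong (λ a b c → shift x 𝟙[ a < b ] 𝟙[ b < c ] (f a b c)) ⟩
  ∑<< (λ a b c → x * f a b c)   ∎
  where
  open ≡-Reasoning
  F : Fin m → Fin m → Fin m → ℕ
  F a b c = 𝟙[ a < b ] * (𝟙[ b < c ] * f a b c)
  shift : ∀ x s t v → x * (s * (t * v)) ≡ s * (t * (x * v))
  shift = solve-∀

∑²≡2*∑< : ∀ {m} (D : Fin m → Fin m → ℕ) →
  (∀ a b → D a b ≡ D b a) → (∀ a → D a a ≡ 0) → ∑² D ≡ 2 * ∑< D
∑²≡2*∑< {m} D D-sym D-refl = begin
  ∑² D                                    ≡⟨ ∑²-cong split ⟩
  ∑² (λ a b → 𝟙[ a < b ] * D a b + D> a b) ≡⟨ ∑²-distrib-+ (λ a b → 𝟙[ a < b ] * D a b) D> ⟩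
  ∑< D + ∑² D>                            ≡⟨ cong (∑< D +_) transpose ⟩
  ∑< D + ∑< D                             ≡⟨ cong (∑< D +_) (sym (+-identityʳ (∑< D))) ⟩
  2 * ∑< D                                ∎
  where
  open ≡-Reasoning
  D> : Fin m → Fin m → ℕ
  D> a b = 𝟙[ b < a ] * D a b
  split : ∀ a b → D a b ≡ 𝟙[ a < b ] * D a b + D> a b
  split a b with <-cmp a b
  ... | tri< a<b _ b≮a rewrite 𝟙<-yes a<b | 𝟙<-no b≮a =
    sym (trans (+-identityʳ (D a b + 0)) (+-identityʳ (D a b)))
  ... | tri≈ _ refl _  rewrite D-refl a =
    sym (cong₂ _+_ (*-zeroʳ 𝟙[ a < a ]) (*-zeroʳ 𝟙[ a < a ]))
  ... | tri> a≮b _ b<a rewrite 𝟙<-no a≮b | 𝟙<-yes b<a =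
    sym (+-identityʳ (D a b))
  transpose : ∑² D> ≡ ∑< D
  transpose = trans (∑-comm D>) (∑²-cong (λ a b → cong (𝟙[ a < b ] *_) (D-sym b a)))

-- Walks and distances

module _ {G : Graph} where

  infixr 5 _++ʷ_

  _++ʷ_ : ∀ {u v w i j} → Walk G u v i → Walk G v w j → Walk G u w (i + j)
  []      ++ʷ q = q
  (e ∷ p) ++ʷ q = e ∷ (p ++ʷ q)

  reverseʷ : ∀ {u v k} → Walk G u v k → Walk G v u k
  reverseʷ []                 = []
  reverseʷ {k = suc k} (e ∷ p) = subst (Walk G _ _) (+-comm k 1) (reverseʷ p ++ʷ (Graph.sym G e ∷ []))

  splitAtVisit : ∀ {u v w k} (p : Walk G u v k) → Visits G w p →
    ∃₂ λ i j → i + j ≡ k × Walk G u w i × Walk G w v j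
  splitAtVisit {k = k} p (here .p) = 0 , k , refl , [] , p
  splitAtVisit (e ∷ p) (there .e .p w∈p) with splitAtVisit p w∈p
  ... | i , j , i+j≡k , p₁ , p₂ = suc i , j , cong suc i+j≡k , e ∷ p₁ , p₂

record Distance (G : Graph) : Set where
  field
    dist     : Fin (n G) → Fin (n G) → ℕ
    geodesic : ∀ u v → Walk G u v (dist u v)
    shortest : ∀ {u v k} → Walk G u v k → dist u v ≤ k

  dist-refl : ∀ u → dist u u ≡ 0
  dist-refl u = n≤0⇒n≡0 (shortest [])

  dist-sym : ∀ u v → dist u v ≡ dist v u
  dist-sym u v = ≤-antisym (shortest (reverseʷ (geodesic v u))) (shortest (reverseʷ (geodesic u v)))

  perimeter : (a b c : Fin (n G)) → ℕ
  perimeter a b c = dist a b + dist b c + dist a c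

  IsMedian : (x y z w : Fin (n G)) → Set
  IsMedian x y z w =
    dist x w + dist y w ≤ dist x y × dist x w + dist z w ≤ dist x z × dist y w + dist z w ≤ dist y z

  HasMedians : Set
  HasMedians = ∀ x y z → ∃ (IsMedian x y z)

  interval⇒median-bound : ∀ {x y w} → InInterval G x y w → dist x w + dist y w ≤ dist x y
  interval⇒median-bound (k , (_ , k-min) , p , w∈p) with splitAtVisit p w∈p
  ... | i , j , i+j≡k , p₁ , p₂ =
    ≤-trans (+-mono-≤ (shortest p₁) (shortest (reverseʷ p₂)))
            (≤-trans (≤-reflexive i+j≡k) (k-min _ (geodesic _ _)))

module _ {G : Graph} (mod : Modular G) where

  -- The interval condition for the triple (x, y, y) supplies d(x, y) together with a geodesic.
  modularDistance : Distance G
  modularDistance = record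
    { dist     = λ x y → proj₁ (distance x y)
    ; geodesic = λ x y → proj₁ (proj₂ (distance x y))
    ; shortest = λ p → proj₂ (proj₂ (distance _ _)) _ p
    }
    where
    distance : ∀ x y → ∃ (IsDist G x y)
    distance x y with proj₂ mod x y y
    ... | _ , (k , k-dist , _) , _ = k , k-dist

  modular-hasMedians : Distance.HasMedians modularDistance
  modular-hasMedians x y z with proj₂ mod x y z
  ... | w , w∈Ixy , w∈Ixz , w∈Iyz = w , bound w∈Ixy , bound w∈Ixz , bound w∈Iyz
    where open Distance modularDistance renaming (interval⇒median-bound to bound)

WienerIndex : ∀ {G} → Distance G → ℕ
WienerIndex D = ∑< (Distance.dist D)

twice-WienerIndex : ∀ {G} (D : Distance G) → ∑² (Distance.dist D) ≡ 2 * WienerIndex D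
twice-WienerIndex D = ∑²≡2*∑< dist dist-sym dist-refl
  where open Distance D

-- The Steiner distance of three vertices

Unique⇒length≤ : ∀ {A : Set} (xs ys : List A) → Unique xs → All (_∈ ys) xs → length xs ≤ length ys
Unique⇒length≤ []       ys _             _           = z≤n
Unique⇒length≤ (x ∷ xs) ys (x∉xs ∷ uniq) (x∈ys ∷ xs⊆ys) with ∈-∃++ x∈ys
... | ys₁ , ys₂ , refl =
  ≤-trans (s≤s (Unique⇒length≤ xs (ys₁ ++ ys₂) uniq (remove-x xs x∉xs xs⊆ys)))
          (≤-reflexive (sym (length-++-sucʳ ys₁ x ys₂)))
  where
  remove-x : ∀ zs → All (x ≢_) zs → All (_∈ ys₁ ++ x ∷ ys₂) zs → All (_∈ ys₁ ++ ys₂) zs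
  remove-x []       _            _            = []
  remove-x (z ∷ zs) (x≢z ∷ x∉zs) (z∈ ∷ zs⊆) = drop-x (∈-++⁻ ys₁ z∈) ∷ remove-x zs x∉zs zs⊆
    where
    drop-x : z ∈ ys₁ ⊎ z ∈ x ∷ ys₂ → z ∈ ys₁ ++ ys₂
    drop-x (inj₁ z∈ys₁)         = ∈-++⁺ˡ z∈ys₁
    drop-x (inj₂ (here z≡x))    = ⊥-elim (x≢z (sym z≡x))
    drop-x (inj₂ (there z∈ys₂)) = ∈-++⁺ʳ ys₁ z∈ys₂

module _ {G : Graph} (S : Subgraph G) where

  private
    V = Fin (n G)

  infix 4 _∈ˢ_

  data _∈ˢ_ (x : V) : ∀ {u v} → SubWalk S u v → Set where
    here  : ∀ {v} (p : SubWalk S x v) → x ∈ˢ p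
    there : ∀ {u w v} (e : EdgeIn S u w) (p : SubWalk S w v) → x ∈ˢ p → x ∈ˢ e ∷ p

  _∈ˢ?_ : ∀ x {u v} (p : SubWalk S u v) → Dec (x ∈ˢ p)
  _∈ˢ?_ x {u} p with x ≟ u
  ... | yes refl = yes (here p)
  x ∈ˢ? [] | no x≢u = no λ { (here _) → x≢u refl }
  x ∈ˢ? (e ∷ p) | no x≢u with x ∈ˢ? p
  ... | yes x∈p = yes (there e p x∈p)
  ... | no x∉p  = no λ { (here _) → x≢u refl ; (there _ _ x∈p) → x∉p x∈p }

  ∈ˢ-end : ∀ {u v} (p : SubWalk S u v) → v ∈ˢ p
  ∈ˢ-end []      = here []
  ∈ˢ-end (e ∷ p) = there e p (∈ˢ-end p)

  IsPath : ∀ {u v} → SubWalk S u v → Set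
  IsPath []          = ⊤
  IsPath {u} (e ∷ p) = ¬ u ∈ˢ p × IsPath p

  Path : V → V → Set
  Path u v = Σ (SubWalk S u v) IsPath

  dropUntil : ∀ {x u v} (p : SubWalk S u v) → IsPath p → x ∈ˢ p → Path x v
  dropUntil p       p-path        (here .p)         = p , p-path
  dropUntil (e ∷ p) (_ , p-path)  (there .e .p x∈p) = dropUntil p p-path x∈p

  eraseLoops : ∀ {u v} → SubWalk S u v → Path u v
  eraseLoops []            = [] , tt
  eraseLoops {u} (e ∷ p) with eraseLoops p
  ... | q , q-path with u ∈ˢ? q
  ...   | yes u∈q = dropUntil q q-path u∈q
  ...   | no u∉q  = e ∷ q , u∉q , q-path

  edgeKey : ∀ {u w} → EdgeIn S u w → V × V
  edgeKey {u} {w} (inj₁ _) = u , w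
  edgeKey {u} {w} (inj₂ _) = w , u

  edgeKey-∈ : ∀ {u w} (e : EdgeIn S u w) → edgeKey e ∈ edges S
  edgeKey-∈ (inj₁ k∈E) = k∈E
  edgeKey-∈ (inj₂ k∈E) = k∈E

  edgeKeys : ∀ {u v} → SubWalk S u v → List (V × V)
  edgeKeys []      = []
  edgeKeys (e ∷ p) = edgeKey e ∷ edgeKeys p

  edgeKeys-⊆ : ∀ {u v} (p : SubWalk S u v) → All (_∈ edges S) (edgeKeys p)
  edgeKeys-⊆ []      = []
  edgeKeys-⊆ (e ∷ p) = edgeKey-∈ e ∷ edgeKeys-⊆ p

  Touches : ∀ {u v} → SubWalk S u v → V × V → Set
  Touches p (x , y) = x ∈ˢ p × y ∈ˢ p

  edgeKey-touches : ∀ {u w v} (e : EdgeIn S u w) (p : SubWalk S w v) → Touches (e ∷ p) (edgeKey e)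
  edgeKey-touches e@(inj₁ _) p = here (e ∷ p) , there e p (here p)
  edgeKey-touches e@(inj₂ _) p = there e p (here p) , here (e ∷ p)

  edgeKeys-touch : ∀ {u v} (p : SubWalk S u v) → All (Touches p) (edgeKeys p)
  edgeKeys-touch []      = []
  edgeKeys-touch (e ∷ p) =
    edgeKey-touches e p ∷ All.map (λ { (x∈p , y∈p) → there e p x∈p , there e p y∈p }) (edgeKeys-touch p)

  ¬Touches-start : ∀ {u w x y} (e : EdgeIn S u w) (q : SubWalk S x y) → ¬ u ∈ˢ q → ¬ Touches q (edgeKey e)
  ¬Touches-start (inj₁ _) q u∉q (u∈q , _) = u∉q u∈q
  ¬Touches-start (inj₂ _) q u∉q (_ , u∈q) = u∉q u∈q

  path⇒unique : ∀ {u v} (p : SubWalk S u v) → IsPath p → Unique (edgeKeys p)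
  path⇒unique []      _              = []
  path⇒unique (e ∷ p) (u∉p , p-path) =
    All.map (λ touches eq → ¬Touches-start e p u∉p (subst (Touches p) (sym eq) touches)) (edgeKeys-touch p)
      ∷ path⇒unique p p-path

  stepAdj : ∀ {u w} → EdgeIn S u w → Adj G u w
  stepAdj (inj₁ k∈E) = proj₁ (proj₂ (All.lookup (edges-ok S) k∈E))
  stepAdj (inj₂ k∈E) = Graph.sym G (proj₁ (proj₂ (All.lookup (edges-ok S) k∈E)))

  toWalk : ∀ {u v} (p : SubWalk S u v) → Walk G u v (length (edgeKeys p))
  toWalk []      = []
  toWalk (e ∷ p) = stepAdj e ∷ toWalk p

  ∈ˢ⇒Visits : ∀ {x u v} {p : SubWalk S u v} → x ∈ˢ p → Visits G x (toWalk p)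
  ∈ˢ⇒Visits (here p)          = here (toWalk p)
  ∈ˢ⇒Visits (there e p x∈p) = there (stepAdj e) (toWalk p) (∈ˢ⇒Visits x∈p)

  module _ {a b} (P : SubWalk S a b) where

    Avoids : ∀ {s m} → SubWalk S s m → Set
    Avoids []          = ⊤
    Avoids {s} (e ∷ r) = ¬ s ∈ˢ P × Avoids r

    avoids⇒¬Touches : ∀ {s m} (r : SubWalk S s m) → Avoids r → All (¬_ ∘ Touches P) (edgeKeys r)
    avoids⇒¬Touches []      _              = []
    avoids⇒¬Touches (e ∷ r) (s∉P , avoids) = ¬Touches-start e P s∉P ∷ avoids⇒¬Touches r avoids

    firstHit : ∀ {s t} (q : SubWalk S s t) → t ∈ˢ P → IsPath q →
      Σ V λ m → m ∈ˢ P × Σ (SubWalk S s m) λ r →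
        IsPath r × Avoids r × (∀ {y} → y ∈ˢ r → y ∈ˢ q)
    firstHit {t = t} [] t∈P _ = t , t∈P , [] , tt , tt , λ y∈[] → y∈[]
    firstHit {s} (e ∷ q) t∈P (s∉q , q-path) with s ∈ˢ? P
    ... | yes s∈P = s , s∈P , [] , tt , tt , λ { (here []) → here (e ∷ q) }
    ... | no s∉P with firstHit q t∈P q-path
    ...   | m , m∈P , r , r-path , avoids , r⊆q =
      m , m∈P , e ∷ r , (s∉q ∘ r⊆q , r-path) , (s∉P , avoids) , ⊆-step
      where
      ⊆-step : ∀ {y} → y ∈ˢ e ∷ r → y ∈ˢ e ∷ q
      ⊆-step (here _)          = here _
      ⊆-step (there _ _ y∈r) = there e q (r⊆q y∈r)

  -- P is a simple a–b path and r a simple path from c to the first vertex m of P it meets. P and r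
  -- share no edge, and the walks a–m–b, b–m–c, a–m–c use each of their edges at most twice.
  connected⇒perimeter≤2*size : (D : Distance G) → ∀ {a b c} → ConnContaining G S a b c →
    Distance.perimeter D a b c ≤ 2 * length (edges S)
  connected⇒perimeter≤2*size D {a} {b} {c} (conn , a∈S , b∈S , c∈S)
    with eraseLoops (conn a b a∈S b∈S) | eraseLoops (conn c b c∈S b∈S)
  ... | P , P-path | Q , Q-path with firstHit P Q (∈ˢ-end P) Q-path
  ... | m , m∈P , r , r-path , r-avoids , _ with splitAtVisit (toWalk P) (∈ˢ⇒Visits m∈P)
  ... | i , j , i+j≡|P| , p₁ , p₂ = ≤-trans distances (*-monoʳ-≤ 2 edge-count)
    where
    open Distance D
    l = length (edgeKeys r)
    distances : perimeter a b c ≤ 2 * (i + j + l)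
    distances = ≤-trans
      (+-mono-≤ (+-mono-≤ (shortest (p₁ ++ʷ p₂)) (shortest (reverseʷ p₂ ++ʷ reverseʷ (toWalk r))))
                (shortest (p₁ ++ʷ reverseʷ (toWalk r))))
      (≤-reflexive (count i j l))
      where
      count : ∀ i j l → i + j + (j + l) + (i + l) ≡ 2 * (i + j + l)
      count = solve-∀
    disjoint : ∀ {k} → ¬ (k ∈ edgeKeys P × k ∈ edgeKeys r)
    disjoint (k∈P , k∈r) =
      All.lookup (avoids⇒¬Touches P r r-avoids) k∈r (All.lookup (edgeKeys-touch P) k∈P)
    edge-count : i + j + l ≤ length (edges S)
    edge-count = begin
      i + j + l                          ≡⟨ cong (_+ l) i+j≡|P| ⟩
      length (edgeKeys P) + l            ≡⟨ sym (length-++ (edgeKeys P)) ⟩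
      length (edgeKeys P ++ edgeKeys r)  ≤⟨ Unique⇒length≤ _ (edges S) unique (++⁺ (edgeKeys-⊆ P) (edgeKeys-⊆ r)) ⟩
      length (edges S)                   ∎
      where
      open ≤-Reasoning
      unique = Unique.++⁺ (path⇒unique P P-path) (path⇒unique r r-path) disjoint

module _ {G : Graph} where

  private
    V = Fin (n G)

  data Oriented (u v : V) : V × V → Set where
    forward  : u Fin.< v → Adj G u v → Oriented u v (u , v)
    backward : v Fin.< u → Adj G v u → Oriented u v (v , u)

  orient : ∀ {u v} → Adj G u v → ∃ (Oriented u v)
  orient {u} {v} e with <-cmp u v
  ... | tri< u<v _ _  = _ , forward u<v e
  ... | tri≈ _ refl _ = ⊥-elim (irref G e)
  ... | tri> _ _ v<u  = _ , backward v<u (Graph.sym G e)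

  walkKeys : ∀ {s t k} → Walk G s t k → List (V × V)
  walkKeys []      = []
  walkKeys (e ∷ q) = proj₁ (orient e) ∷ walkKeys q

  length-walkKeys : ∀ {s t k} (q : Walk G s t k) → length (walkKeys q) ≡ k
  length-walkKeys []      = refl
  length-walkKeys (e ∷ q) = cong suc (length-walkKeys q)

  Link : List (V × V) → V → V → Set
  Link L u v = (u , v) ∈ L ⊎ (v , u) ∈ L

  data ListWalk (L : List (V × V)) : V → V → Set where
    []  : ∀ {u} → ListWalk L u u
    _∷_ : ∀ {u x v} → Link L u x → ListWalk L x v → ListWalk L u v

  module _ {L : List (V × V)} where

    _++ˡ_ : ∀ {u v x} → ListWalk L u v → ListWalk L v x → ListWalk L u x
    []      ++ˡ q = q
    (e ∷ p) ++ˡ q = e ∷ (p ++ˡ q)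

    reverseˡ : ∀ {u v} → ListWalk L u v → ListWalk L v u
    reverseˡ []           = []
    reverseˡ (inj₁ e ∷ p) = reverseˡ p ++ˡ (inj₂ e ∷ [])
    reverseˡ (inj₂ e ∷ p) = reverseˡ p ++ˡ (inj₁ e ∷ [])

  module _ (L : List (V × V)) (w : V) where

    Reaches : V → Set
    Reaches x = ListWalk L x w

    GoodEdge : V × V → Set
    GoodEdge (x , y) = x Fin.< y × Adj G x y × Reaches x × Reaches y

    good-step : ∀ {s s' k} → Oriented s s' k → k ∈ L → Reaches s → GoodEdge k × Reaches s'
    good-step (forward s<s' e)  k∈L s↝w = (s<s' , e , s↝w , s'↝w) , s'↝w
      where s'↝w = inj₂ k∈L ∷ s↝w
    good-step (backward s'<s e) k∈L s↝w = (s'<s , e , s'↝w , s↝w) , s'↝w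
      where s'↝w = inj₁ k∈L ∷ s↝w

    walk-good : ∀ {s t k} (q : Walk G s t k) → Reaches s → All (_∈ L) (walkKeys q) →
      All GoodEdge (walkKeys q) × Reaches t
    walk-good []      s↝w _              = [] , s↝w
    walk-good (e ∷ q) s↝w (k∈L ∷ keys∈L) with good-step (proj₂ (orient e)) k∈L s↝w
    ... | k-good , s'↝w with walk-good q s'↝w keys∈L
    ...   | keys-good , t↝w = k-good ∷ keys-good , t↝w

  spanningSubgraph : ∀ {w a b c k₁ k₂ k₃} → Walk G w a k₁ → Walk G w b k₂ → Walk G w c k₃ →
    Σ (Subgraph G) λ S → ConnContaining G S a b c × length (edges S) ≤ k₁ + k₂ + k₃
  spanningSubgraph {w} {k₁ = k₁} {k₂} {k₃} q₁ q₂ q₃ =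
    S , (connected , a↝w , b↝w , c↝w) , edge-count
    where
    _≟ₑ_ = ≡-dec _≟_ _≟_
    L₀ = walkKeys q₁ ++ walkKeys q₂ ++ walkKeys q₃
    L  = deduplicate _≟ₑ_ L₀
    ∈L : ∀ {k} → k ∈ L₀ → k ∈ L
    ∈L = ∈-deduplicate⁺ _≟ₑ_
    run₁ = walk-good L w q₁ [] (All.tabulate λ k∈ → ∈L (∈-++⁺ˡ k∈))
    run₂ = walk-good L w q₂ [] (All.tabulate λ k∈ → ∈L (∈-++⁺ʳ (walkKeys q₁) (∈-++⁺ˡ k∈)))
    run₃ = walk-good L w q₃ [] (All.tabulate λ k∈ → ∈L (∈-++⁺ʳ (walkKeys q₁) (∈-++⁺ʳ (walkKeys q₂) k∈)))
    a↝w = proj₂ run₁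
    b↝w = proj₂ run₂
    c↝w = proj₂ run₃
    L₀-good : All (GoodEdge L w) L₀
    L₀-good = ++⁺ (proj₁ run₁) (++⁺ (proj₁ run₂) (proj₁ run₃))
    S : Subgraph G
    S = record
      { inV      = Reaches L w
      ; edges    = L
      ; edges-ok = All.tabulate (λ k∈L → All.lookup L₀-good (∈-deduplicate⁻ _≟ₑ_ L₀ k∈L))
      ; distinct = deduplicate-! _≟ₑ_ L₀
      }
    toSubWalk : ∀ {u v} → ListWalk L u v → SubWalk S u v
    toSubWalk []      = []
    toSubWalk (e ∷ p) = e ∷ toSubWalk p
    connected : SubConnected S
    connected u v u↝w v↝w = toSubWalk (u↝w ++ˡ reverseˡ v↝w)
    edge-count : length L ≤ k₁ + k₂ + k₃
    edge-count = begin
      length L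
        ≤⟨ Unique⇒length≤ L L₀ (deduplicate-! _≟ₑ_ L₀) (All.tabulate (∈-deduplicate⁻ _≟ₑ_ L₀)) ⟩
      length L₀
        ≡⟨ trans (length-++ (walkKeys q₁)) (cong (length (walkKeys q₁) +_) (length-++ (walkKeys q₂))) ⟩
      length (walkKeys q₁) + (length (walkKeys q₂) + length (walkKeys q₃))
        ≡⟨ cong₂ _+_ (length-walkKeys q₁) (cong₂ _+_ (length-walkKeys q₂) (length-walkKeys q₃)) ⟩
      k₁ + (k₂ + k₃)
        ≡⟨ sym (+-assoc k₁ k₂ k₃) ⟩
      k₁ + k₂ + k₃
        ∎
      where open ≤-Reasoning

module _ {G : Graph} (D : Distance G) (medians : Distance.HasMedians D) where

  open Distance D

  steinerDist-perimeter : ∀ {a b c k} → IsSteinerDist G a b c k → 2 * k ≡ perimeter a b c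
  steinerDist-perimeter {a} {b} {c} {k} ((S , S-conn , |S|≡k) , k-min) = ≤-antisym upper lower
    where
    lower : perimeter a b c ≤ 2 * k
    lower = subst (λ l → perimeter a b c ≤ 2 * l) |S|≡k (connected⇒perimeter≤2*size S D S-conn)
    upper : 2 * k ≤ perimeter a b c
    upper with medians a b c
    ... | w , ab-bound , ac-bound , bc-bound
      with spanningSubgraph (reverseʷ (geodesic a w)) (reverseʷ (geodesic b w)) (reverseʷ (geodesic c w))
    ... | T , T-conn , |T|≤ = begin
      2 * k                                          ≤⟨ *-monoʳ-≤ 2 (≤-trans (k-min T T-conn) |T|≤) ⟩
      2 * (dist a w + dist b w + dist c w)           ≡⟨ regroup (dist a w) (dist b w) (dist c w) ⟩
      (dist a w + dist b w) + (dist b w + dist c w) + (dist a w + dist c w)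
                                                     ≤⟨ +-mono-≤ (+-mono-≤ ab-bound bc-bound) ac-bound ⟩
      perimeter a b c                                ∎
      where
      open ≤-Reasoning
      regroup : ∀ x y z → 2 * (x + y + z) ≡ (x + y) + (y + z) + (x + z)
      regroup = solve-∀

  SW3-wiener : ∀ {d} → IsSteiner3 G d → 2 * SW3 G d ≡ (n G ∸ 2) * WienerIndex D
  SW3-wiener {d} steiner = begin
    2 * SW3 G d                   ≡⟨ cong (2 *_) (sum-triples (n G) d) ⟩
    2 * ∑<< d                     ≡⟨ *-distribˡ-∑<< 2 d ⟩
    ∑<< (λ a b c → 2 * d a b c)   ≡⟨ ∑<<-cong (λ a b c a<b b<c → steinerDist-perimeter (steiner a b c a<b b<c)) ⟩
    ∑<< perimeter                 ≡⟨ ∑<<-pairs dist ⟩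
    (n G ∸ 2) * WienerIndex D     ∎
    where open ≡-Reasoning

-- Cartesian products

module _ (G H : Graph) where

  private
    VG = Fin (n G)
    VH = Fin (n H)

  vertex : Fin (n (G □ H)) → VG × VH
  vertex = remQuot (n H)

  ProductAdj : VG × VH → VG × VH → Set
  ProductAdj (a , x) (b , y) = (Adj G a b × x ≡ y) ⊎ (a ≡ b × Adj H x y)

  □-adj : ∀ {a b x y} → ProductAdj (a , x) (b , y) → Adj (G □ H) (combine a x) (combine b y)
  □-adj {a} {b} {x} {y} = subst₂ ProductAdj (sym (remQuot-combine a x)) (sym (remQuot-combine b y))

  liftˡ : ∀ {a b k} (x : VH) → Walk G a b k → Walk (G □ H) (combine a x) (combine b x) k
  liftˡ x []      = []
  liftˡ x (e ∷ p) = □-adj (inj₁ (e , refl)) ∷ liftˡ x p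

  liftʳ : ∀ {x y k} (a : VG) → Walk H x y k → Walk (G □ H) (combine a x) (combine a y) k
  liftʳ a []      = []
  liftʳ a (e ∷ p) = □-adj (inj₂ (refl , e)) ∷ liftʳ a p

  project : ∀ {i j k} → Walk (G □ H) i j k → ∃₂ λ p q → p + q ≡ k ×
    Walk G (proj₁ (vertex i)) (proj₁ (vertex j)) p × Walk H (proj₂ (vertex i)) (proj₂ (vertex j)) q
  project [] = 0 , 0 , refl , [] , []
  project (e ∷ w) with project w
  project (inj₁ (e , x≡y) ∷ w) | p , q , p+q≡k , wG , wH =
    suc p , q , cong suc p+q≡k , e ∷ wG , subst (λ x → Walk H x _ q) (sym x≡y) wH
  project (inj₂ (a≡b , e) ∷ w) | p , q , p+q≡k , wG , wH =
    p , suc q , trans (+-suc p q) (cong suc p+q≡k) , subst (λ a → Walk G a _ p) (sym a≡b) wG , e ∷ wH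

  module _ (DG : Distance G) (DH : Distance H) where

    private
      module DG = Distance DG
      module DH = Distance DH

    productDist : Fin (n (G □ H)) → Fin (n (G □ H)) → ℕ
    productDist i j =
      DG.dist (proj₁ (vertex i)) (proj₁ (vertex j)) + DH.dist (proj₂ (vertex i)) (proj₂ (vertex j))

    productGeodesic : ∀ i j → Walk (G □ H) i j (productDist i j)
    productGeodesic i j =
      subst₂ (λ s t → Walk (G □ H) s t (productDist i j))
             (combine-remQuot {n G} (n H) i) (combine-remQuot {n G} (n H) j)
        (liftˡ (proj₂ (vertex i)) (DG.geodesic _ _) ++ʷ liftʳ (proj₁ (vertex j)) (DH.geodesic _ _))

    productShortest : ∀ {i j k} → Walk (G □ H) i j k → productDist i j ≤ k
    productShortest w with project w
    ... | p , q , p+q≡k , wG , wH = ≤-trans (+-mono-≤ (DG.shortest wG) (DH.shortest wH)) (≤-reflexive p+q≡k)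

    productDistance : Distance (G □ H)
    productDistance = record { dist = productDist ; geodesic = productGeodesic ; shortest = productShortest }

    open Distance productDistance

    productDistance-combine : ∀ a x b y → dist (combine a x) (combine b y) ≡ DG.dist a b + DH.dist x y
    productDistance-combine a x b y =
      cong₂ (λ u v → DG.dist (proj₁ u) (proj₁ v) + DH.dist (proj₂ u) (proj₂ v))
            (remQuot-combine a x) (remQuot-combine b y)

    product-hasMedians : DG.HasMedians → DH.HasMedians → HasMedians
    product-hasMedians G-medians H-medians i j k
      with G-medians (proj₁ (vertex i)) (proj₁ (vertex j)) (proj₁ (vertex k))
         | H-medians (proj₂ (vertex i)) (proj₂ (vertex j)) (proj₂ (vertex k))
    ... | wG , G₁ , G₂ , G₃ | wH , H₁ , H₂ , H₃ =
      combine wG wH , median G₁ H₁ , median G₂ H₂ , median G₃ H₃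
      where
      median : ∀ {a b x y s t} → DG.dist a wG + DG.dist b wG ≤ s → DH.dist x wH + DH.dist y wH ≤ t →
        DG.dist a (proj₁ (vertex (combine wG wH))) + DH.dist x (proj₂ (vertex (combine wG wH)))
          + (DG.dist b (proj₁ (vertex (combine wG wH))) + DH.dist y (proj₂ (vertex (combine wG wH)))) ≤ s + t
      median {a} {b} {x} {y} G-bound H-bound = ≤-trans
        (≤-reflexive (trans (cong sum-at (remQuot-combine wG wH))
          (interchange (DG.dist a wG) (DH.dist x wH) (DG.dist b wG) (DH.dist y wH))))
        (+-mono-≤ G-bound H-bound)
        where
        sum-at : VG × VH → ℕ
        sum-at (u , v) = DG.dist a u + DH.dist x v + (DG.dist b u + DH.dist y v)
        interchange : ∀ p q r s → p + q + (r + s) ≡ p + r + (q + s)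
        interchange = solve-∀

WienerIndex-□ : ∀ {G H} (DG : Distance G) (DH : Distance H) →
  WienerIndex (productDistance G H DG DH) ≡ n H * n H * WienerIndex DG + n G * n G * WienerIndex DH
WienerIndex-□ {G} {H} DG DH = *-cancelˡ-≡ _ _ 2 (begin
  2 * WienerIndex DP
    ≡⟨ sym (twice-WienerIndex DP) ⟩
  ∑² (Distance.dist DP)
    ≡⟨ ∑²-combine g h _ _ _ (productDistance-combine G H DG DH) ⟩
  h * h * ∑² (Distance.dist DG) + g * g * ∑² (Distance.dist DH)
    ≡⟨ cong₂ (λ u v → h * h * u + g * g * v) (twice-WienerIndex DG) (twice-WienerIndex DH) ⟩
  h * h * (2 * WienerIndex DG) + g * g * (2 * WienerIndex DH)
    ≡⟨ factor-2 (h * h) (g * g) (WienerIndex DG) (WienerIndex DH) ⟩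
  2 * (h * h * WienerIndex DG + g * g * WienerIndex DH)
    ∎)
  where
  open ≡-Reasoning
  g = n G
  h = n H
  DP = productDistance G H DG DH
  factor-2 : ∀ p q x y → p * (2 * x) + q * (2 * y) ≡ 2 * (p * x + q * y)
  factor-2 = solve-∀

SW3-□-arithmetic : ∀ g h g₂ h₂ N₂ sG sH sP WG WH →
  2 * sG ≡ g₂ * WG → 2 * sH ≡ h₂ * WH → 2 * sP ≡ N₂ * (h * h * WG + g * g * WH) →
  sP * (g₂ * h₂) ≡ N₂ * (g ^ 2 * g₂ * sH + h ^ 2 * h₂ * sG)
SW3-□-arithmetic g h g₂ h₂ N₂ sG sH sP WG WH sG≡ sH≡ sP≡ = *-cancelˡ-≡ _ _ 4 (begin
  4 * (sP * (g₂ * h₂))                                    ≡⟨ step₁ sP g₂ h₂ ⟩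
  2 * sP * (2 * (g₂ * h₂))                                ≡⟨ cong (_* (2 * (g₂ * h₂))) sP≡ ⟩
  N₂ * (h * h * WG + g * g * WH) * (2 * (g₂ * h₂))        ≡⟨ step₂ N₂ g h g₂ h₂ WG WH ⟩
  2 * N₂ * (g ^ 2 * g₂ * (h₂ * WH) + h ^ 2 * h₂ * (g₂ * WG))
    ≡⟨ cong₂ (λ u v → 2 * N₂ * (g ^ 2 * g₂ * u + h ^ 2 * h₂ * v)) (sym sH≡) (sym sG≡) ⟩
  2 * N₂ * (g ^ 2 * g₂ * (2 * sH) + h ^ 2 * h₂ * (2 * sG)) ≡⟨ step₃ N₂ g h g₂ h₂ sG sH ⟩
  4 * (N₂ * (g ^ 2 * g₂ * sH + h ^ 2 * h₂ * sG))          ∎)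
  where
  open ≡-Reasoning
  step₁ : ∀ s p q → 4 * (s * (p * q)) ≡ 2 * s * (2 * (p * q))
  step₁ = solve-∀
  -- The ring solver does not recognise Data.Nat._^_, so g ^ 2 is written out as g * (g * 1).
  step₂ : ∀ N g h p q x y →
    N * (h * h * x + g * g * y) * (2 * (p * q)) ≡ 2 * N * (g * (g * 1) * p * (q * y) + h * (h * 1) * q * (p * x))
  step₂ = solve-∀
  step₃ : ∀ N g h p q x y → 2 * N * (g * (g * 1) * p * (2 * y) + h * (h * 1) * q * (2 * x))
                          ≡ 4 * (N * (g * (g * 1) * p * y + h * (h * 1) * q * x))
  step₃ = solve-∀

mainTheorem2 : (G H : Graph) → Modular G → Modular H → 3 ≤ n G → 3 ≤ n H →
    (dG : Fin (n G) → Fin (n G) → Fin (n G) → ℕ) → IsSteiner3 G dG →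
    (dH : Fin (n H) → Fin (n H) → Fin (n H) → ℕ) → IsSteiner3 H dH →
    (dGH : Fin (n (G □ H)) → Fin (n (G □ H)) → Fin (n (G □ H)) → ℕ) → IsSteiner3 (G □ H) dGH →
    SW3 (G □ H) dGH * ((n G ∸ 2) * (n H ∸ 2))
      ≡ (n G * n H ∸ 2) * (n G ^ 2 * (n G ∸ 2) * SW3 H dH + n H ^ 2 * (n H ∸ 2) * SW3 G dG)
mainTheorem2 G H G-mod H-mod _ _ dG G-steiner dH H-steiner dGH GH-steiner =
  SW3-□-arithmetic (n G) (n H) (n G ∸ 2) (n H ∸ 2) (n G * n H ∸ 2) (SW3 G dG) (SW3 H dH) (SW3 (G □ H) dGH)
    (WienerIndex DG) (WienerIndex DH)
    (SW3-wiener DG G-medians G-steiner)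
    (SW3-wiener DH H-medians H-steiner)
    (trans (SW3-wiener DGH (product-hasMedians G H DG DH G-medians H-medians) GH-steiner)
           (cong ((n G * n H ∸ 2) *_) (WienerIndex-□ DG DH)))
  where
  DG = modularDistance G-mod
  DH = modularDistance H-mod
  DGH = productDistance G H DG DH
  G-medians = modular-hasMedians G-mod
  H-medians = modular-hasMedians H-mod
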